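{- Let $n\in\mathbb{N}$, let $\mathcal{F}$ be the set of all functions $[n]\to[n]$, and let $\mathsf{Inv}:\mathcal{F}\times[n]\to[n]$ be a function such that $\Pr_{f\leftarrow\mathcal{F},\,x\leftarrow[n]}\big[\mathsf{Inv}(f,f(x))\in f^{ -1}(f(x))\big]\ge\alpha$. Then $\Pr_{f\leftarrow\mathcal{F},\,x\leftarrow[n]}\big[\mathsf{Inv}(f,f(x))=x\big]\ge\frac{\alpha^2}{8}$.
   Context: $f\leftarrow\mathcal{F}$ and $x\leftarrow[n]$ are independent uniform choices; $f^{ -1}(y)=\{x\in[n]: f(x)=y\}$. -}

module Defs where

open import Data.Nat using (ℕ; zero; suc; _+_; _*_; _^_; NonZero)
open import Data.Nat.Properties using (m*n≢0; m^n≢0)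
open import Data.Fin using (Fin; _≟_)
open import Data.Bool using (Bool; if_then_else_)
open import Data.List using (List; []; _∷_; map; concatMap; allFin)
open import Data.Nat.ListAction using (sum)
open import Data.Vec.Functional using (Vector) renaming (_∷_ to _◂_)
open import Data.Integer using (+_)
open import Data.Rational using (ℚ; _/_)
open import Relation.Nullary using (does)

-- [n] is modelled as Fin n.  The list of all functions Fin m → Fin n
-- (each appears exactly once, so this enumerates the uniform space 𝓕).
allFuns : (m n : ℕ) → List (Fin m → Fin n)
allFuns zero    n = (λ ()) ∷ []
allFuns (suc m) n = concatMap (λ y → map (λ g → y ◂ g) (allFuns m n)) (allFin n)

countPairs : (n : ℕ) → ((Fin n → Fin n) → Fin n → Bool) → ℕ
countPairs n P =
  sum (map (λ f → sum (map (λ x → if P f x then 1 else 0) (allFin n))) (allFuns n n))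

Pr : (n : ℕ) → .{{_ : NonZero n}} → ((Fin n → Fin n) → Fin n → Bool) → ℚ
Pr n P = (+ countPairs n P) / (n ^ n * n)
  where instance
    nz : NonZero (n ^ n * n)
    nz = m*n≢0 (n ^ n) n {{m^n≢0 n n}}

invertsEvent : (n : ℕ) → ((Fin n → Fin n) → Fin n → Fin n) → (Fin n → Fin n) → Fin n → Bool
invertsEvent n Inv f x = does (f (Inv f (f x)) ≟ f x)

findsEvent : (n : ℕ) → ((Fin n → Fin n) → Fin n → Fin n) → (Fin n → Fin n) → Fin n → Bool
findsEvent n Inv f x = does (Inv f (f x) ≟ x)

-- Fix f and the inverter J = Inv f. Whenever f (J (f x)) = f x, the point x₀ = J (f x) is found
-- (J (f x₀) = x₀) and lies in the fiber of x, so #inverted ≤ ∑ₓ [x found]·|f⁻¹(f x)|. By Cauchy–Schwarz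
-- the square of this is at most #found · ∑ₓ [x found]·|f⁻¹(f x)|², and as each fiber contains at most
-- one found point, the last sum is at most the number ∑ₓ |f⁻¹(f x)| of colliding pairs. Summing over f
-- with Cauchy–Schwarz once more, and using that a uniform f : [n] → [n] has 2n − 1 colliding pairs on
-- average, gives (#inverted)² ≤ #found · 2 nⁿ⁺¹ for the counts over all pairs (f, x), i.e. α² ≤ 2 Pr[Inv(f, f x) = x].
module Submission where

open import Data.Nat using (ℕ; zero; suc; _+_; _*_; _^_; _≤_; z≤n; s≤s; NonZero)
open import Data.Nat.Properties hiding (_≟_)
open import Data.Nat.Tactic.RingSolver using (solve-∀)
open import Data.Nat.ListAction using (sum)
open import Data.Nat.ListAction.Properties using (sum-++)
open import Data.Bool using (Bool; if_then_else_)
open import Data.Fin using (Fin; zero; suc; _≟_)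
open import Data.List using (List; []; _∷_; _++_; map; concatMap; allFin; length)
open import Data.List.Properties using (map-++; map-cong; map-∘; map-tabulate; length-tabulate)
open import Data.List.Membership.Propositional using (_∈_)
open import Data.List.Membership.Propositional.Properties using (∈-allFin)
open import Data.List.Relation.Unary.Any using (here; there)
open import Data.Vec.Functional using () renaming (_∷_ to _◂_)
open import Data.Product using (_,_)
open import Data.Sum using (inj₁; inj₂)
open import Function using (_∘_; id; mk⇔)
open import Relation.Nullary using (Dec; yes; no; does)
open import Relation.Nullary.Decidable using (dec-true; does-⇔)
open import Relation.Binary.PropositionalEquality
import Data.Integer as ℤ
import Data.Integer.Properties as ℤ
import Data.Rational as ℚ
import Data.Rational.Properties as ℚ
import Data.Rational.Unnormalised as ℚᵘ
import Data.Rational.Unnormalised.Properties as ℚᵘ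
open import Defs

private variable
  A B : Set
  P Q R : Set
  m k : ℕ

𝟙 : Bool → ℕ
𝟙 b = if b then 1 else 0

𝟙-yes : (P? : Dec P) → P → 𝟙 (does P?) ≡ 1
𝟙-yes P? p = cong 𝟙 (dec-true P? p)

𝟙-≤ : ∀ {n} (P? : Dec P) → (P → 1 ≤ n) → 𝟙 (does P?) ≤ n
𝟙-≤ (yes p) 1≤n = 1≤n p
𝟙-≤ (no _)  _   = z≤n

𝟙-*-≤ : (P? : Dec P) (Q? : Dec Q) (R? : Dec R) → (P → Q → R) →
        𝟙 (does P?) * 𝟙 (does Q?) ≤ 𝟙 (does R?)
𝟙-*-≤ (yes p) (yes q) R? pq⇒r = ≤-reflexive (sym (𝟙-yes R? (pq⇒r p q)))
𝟙-*-≤ (yes _) (no _)  _  _    = z≤n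
𝟙-*-≤ (no _)  _       _  _    = z≤n

𝟙-*-cong : ∀ {a b} (P? : Dec P) → (P → a ≡ b) → a * 𝟙 (does P?) ≡ b * 𝟙 (does P?)
𝟙-*-cong             (yes p) a≡b = cong (_* 1) (a≡b p)
𝟙-*-cong {a = a} {b} (no _)  _   = trans (*-zeroʳ a) (sym (*-zeroʳ b))

𝟙-≟-sym : ∀ (a b : Fin m) → 𝟙 (does (a ≟ b)) ≡ 𝟙 (does (b ≟ a))
𝟙-≟-sym a b = cong 𝟙 (does-⇔ (mk⇔ sym sym) (a ≟ b) (b ≟ a))

∑ : List A → (A → ℕ) → ℕ
∑ xs h = sum (map h xs)

infix 5 ∑
syntax ∑ xs (λ a → e) = ∑[ a ∈ xs ] e

∑-cong : ∀ (xs : List A) {h h′ : A → ℕ} → (∀ a → h a ≡ h′ a) → ∑ xs h ≡ ∑ xs h′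
∑-cong xs h≗h′ = cong sum (map-cong h≗h′ xs)

∑-mono-≤ : ∀ (xs : List A) {h h′ : A → ℕ} → (∀ a → h a ≤ h′ a) → ∑ xs h ≤ ∑ xs h′
∑-mono-≤ []       h≤h′ = z≤n
∑-mono-≤ (x ∷ xs) h≤h′ = +-mono-≤ (h≤h′ x) (∑-mono-≤ xs h≤h′)

∑-∈-≤ : ∀ {xs : List A} {x} (h : A → ℕ) → x ∈ xs → h x ≤ ∑ xs h
∑-∈-≤ h (here refl) = m≤m+n _ _
∑-∈-≤ {xs = y ∷ _} h (there x∈xs) = ≤-trans (∑-∈-≤ h x∈xs) (m≤n+m _ (h y))

∑-const : ∀ (xs : List A) c → ∑[ _ ∈ xs ] c ≡ length xs * c
∑-const []       c = refl
∑-const (x ∷ xs) c = cong (c +_) (∑-const xs c)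

∑-distrib-+ : ∀ xs (h h′ : A → ℕ) → ∑[ a ∈ xs ] (h a + h′ a) ≡ ∑ xs h + ∑ xs h′
∑-distrib-+ []       h h′ = refl
∑-distrib-+ (x ∷ xs) h h′ = trans (cong (h x + h′ x +_) (∑-distrib-+ xs h h′))
                                  (+-interchange (h x) (h′ x) (∑ xs h) (∑ xs h′))
  where
  +-interchange : ∀ a b c d → a + b + (c + d) ≡ a + c + (b + d)
  +-interchange = solve-∀

∑-*ˡ : ∀ xs c (h : A → ℕ) → ∑[ a ∈ xs ] c * h a ≡ c * ∑ xs h
∑-*ˡ []       c h = sym (*-zeroʳ c)
∑-*ˡ (x ∷ xs) c h = trans (cong (c * h x +_) (∑-*ˡ xs c h)) (sym (*-distribˡ-+ c (h x) (∑ xs h)))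

∑-comm : ∀ (xs : List A) (ys : List B) (h : A → B → ℕ) →
         ∑[ a ∈ xs ] ∑ ys (h a) ≡ ∑[ b ∈ ys ] ∑[ a ∈ xs ] h a b
∑-comm []       ys h = sym (trans (∑-const ys 0) (*-zeroʳ (length ys)))
∑-comm (x ∷ xs) ys h = trans (cong (∑ ys (h x) +_) (∑-comm xs ys h))
                             (sym (∑-distrib-+ ys (h x) (λ b → ∑[ a ∈ xs ] h a b)))

∑-++ : ∀ (xs ys : List A) h → ∑ (xs ++ ys) h ≡ ∑ xs h + ∑ ys h
∑-++ xs ys h = trans (cong sum (map-++ h xs ys)) (sum-++ (map h xs) (map h ys))

∑-concatMap : ∀ (F : A → List B) xs h → ∑ (concatMap F xs) h ≡ ∑[ a ∈ xs ] ∑ (F a) h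
∑-concatMap F []       h = refl
∑-concatMap F (x ∷ xs) h = trans (∑-++ (F x) (concatMap F xs) h) (cong (∑ (F x) h +_) (∑-concatMap F xs h))

∑-map : ∀ (g : A → B) xs h → ∑ (map g xs) h ≡ ∑[ a ∈ xs ] h (g a)
∑-map g xs h = cong sum (sym (map-∘ xs))

∑-allFin-suc : ∀ m (h : Fin (suc m) → ℕ) → ∑ (allFin (suc m)) h ≡ h zero + (∑[ x ∈ allFin m ] h (suc x))
∑-allFin-suc m h = cong (λ ys → h zero + sum ys) (trans (map-tabulate suc h) (sym (map-tabulate id (h ∘ suc))))

∑-allFin-const : ∀ m c → ∑[ _ ∈ allFin m ] c ≡ m * c
∑-allFin-const m c = trans (∑-const (allFin m) c) (cong (_* c) (length-tabulate {n = m} id))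

∑-indicator : ∀ m (z : Fin m) → ∑[ x ∈ allFin m ] 𝟙 (does (x ≟ z)) ≡ 1
∑-indicator (suc m) z = trans (∑-allFin-suc m (λ x → 𝟙 (does (x ≟ z)))) (split z)
  where
  split : ∀ z → 𝟙 (does (zero ≟ z)) + (∑[ x ∈ allFin m ] 𝟙 (does (suc x ≟ z))) ≡ 1
  split zero    = cong suc (trans (∑-allFin-const m 0) (*-zeroʳ m))
  split (suc z) = ∑-indicator m z

∑-indicatorˡ : ∀ m (z : Fin m) → ∑[ x ∈ allFin m ] 𝟙 (does (z ≟ x)) ≡ 1
∑-indicatorˡ m z = trans (∑-cong (allFin m) (𝟙-≟-sym z)) (∑-indicator m z)

2*m*n≤m*m+n*n : ∀ m n → 2 * m * n ≤ m * m + n * n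
2*m*n≤m*m+n*n m n with ≤-total m n
... | inj₁ m≤n with m≤n⇒∃[o]m+o≡n m≤n
...   | o , refl = subst (2 * m * (m + o) ≤_) (square-gap m o) (m≤m+n _ (o * o))
  where
  square-gap : ∀ m o → 2 * m * (m + o) + o * o ≡ m * m + (m + o) * (m + o)
  square-gap = solve-∀
2*m*n≤m*m+n*n m n | inj₂ n≤m with m≤n⇒∃[o]m+o≡n n≤m
...   | o , refl = subst (2 * (n + o) * n ≤_) (square-gap n o) (m≤m+n _ (o * o))
  where
  square-gap : ∀ n o → 2 * (n + o) * n + o * o ≡ (n + o) * (n + o) + n * n
  square-gap = solve-∀

m*m≤n*o⇒2*m≤n+o : ∀ m n o → m * m ≤ n * o → 2 * m ≤ n + o
m*m≤n*o⇒2*m≤n+o m n o m*m≤n*o = ≮⇒≥ λ n+o<2*m →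
  <⇒≱ (*-mono-< n+o<2*m n+o<2*m) (begin
    2 * m * (2 * m)              ≡⟨ e₁ m ⟩
    4 * (m * m)                  ≤⟨ *-monoʳ-≤ 4 m*m≤n*o ⟩
    4 * (n * o)                  ≡⟨ e₂ n o ⟩
    2 * n * o + 2 * n * o        ≤⟨ +-monoʳ-≤ (2 * n * o) (2*m*n≤m*m+n*n n o) ⟩
    2 * n * o + (n * n + o * o)  ≡⟨ e₃ n o ⟩
    (n + o) * (n + o)            ∎)
  where
  open ≤-Reasoning
  e₁ : ∀ m → 2 * m * (2 * m) ≡ 4 * (m * m)
  e₁ = solve-∀
  e₂ : ∀ n o → 4 * (n * o) ≡ 2 * n * o + 2 * n * o
  e₂ = solve-∀
  e₃ : ∀ n o → 2 * n * o + (n * n + o * o) ≡ (n + o) * (n + o)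
  e₃ = solve-∀

cauchy-schwarz : ∀ (h b c : A → ℕ) → (∀ a → h a * h a ≤ b a * c a) →
                 ∀ xs → ∑ xs h * ∑ xs h ≤ ∑ xs b * ∑ xs c
cauchy-schwarz h b c h²≤bc []       = z≤n
cauchy-schwarz h b c h²≤bc (x ∷ xs) = begin
  (h x + Σh) * (h x + Σh)                       ≡⟨ e₁ (h x) Σh ⟩
  h x * h x + 2 * (h x * Σh) + Σh * Σh          ≤⟨ +-mono-≤ (+-mono-≤ (h²≤bc x) cross) IH ⟩
  b x * c x + (b x * Σc + Σb * c x) + Σb * Σc   ≡⟨ e₂ (b x) (c x) Σb Σc ⟩
  (b x + Σb) * (c x + Σc)                       ∎
  where
  open ≤-Reasoning
  Σh Σb Σc : ℕ
  Σh = ∑ xs h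
  Σb = ∑ xs b
  Σc = ∑ xs c
  IH : Σh * Σh ≤ Σb * Σc
  IH = cauchy-schwarz h b c h²≤bc xs
  e₁ : ∀ a s → (a + s) * (a + s) ≡ a * a + 2 * (a * s) + s * s
  e₁ = solve-∀
  e₂ : ∀ b c s t → b * c + (b * t + s * c) + s * t ≡ (b + s) * (c + t)
  e₂ = solve-∀
  e₃ : ∀ a s → a * s * (a * s) ≡ a * a * (s * s)
  e₃ = solve-∀
  e₄ : ∀ b c s t → b * c * (s * t) ≡ b * t * (s * c)
  e₄ = solve-∀
  cross : 2 * (h x * Σh) ≤ b x * Σc + Σb * c x
  cross = m*m≤n*o⇒2*m≤n+o (h x * Σh) (b x * Σc) (Σb * c x) (begin
    h x * Σh * (h x * Σh)   ≡⟨ e₃ (h x) Σh ⟩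
    h x * h x * (Σh * Σh)   ≤⟨ *-mono-≤ (h²≤bc x) IH ⟩
    b x * c x * (Σb * Σc)   ≡⟨ e₄ (b x) (c x) Σb Σc ⟩
    b x * Σc * (Σb * c x)   ∎)

fiberSize : (Fin m → Fin k) → Fin m → ℕ
fiberSize {m} f x = ∑[ x′ ∈ allFin m ] 𝟙 (does (f x ≟ f x′))

fiberSize-cong : ∀ (f : Fin m → Fin k) {x x′} → f x ≡ f x′ → fiberSize f x ≡ fiberSize f x′
fiberSize-cong {m} f fx≡fx′ = cong (λ y → ∑[ x″ ∈ allFin m ] 𝟙 (does (y ≟ f x″))) fx≡fx′

collisions : (Fin m → Fin k) → ℕ
collisions {m} f = ∑[ x ∈ allFin m ] fiberSize f x

inverts : (Fin m → Fin k) → (Fin k → Fin m) → ℕ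
inverts {m} f J = ∑[ x ∈ allFin m ] 𝟙 (does (f (J (f x)) ≟ f x))

finds : (Fin m → Fin k) → (Fin k → Fin m) → ℕ
finds {m} f J = ∑[ x ∈ allFin m ] 𝟙 (does (J (f x) ≟ x))

module _ (f : Fin m → Fin k) (J : Fin k → Fin m) where

  private
    found : Fin m → ℕ
    found x = 𝟙 (does (J (f x) ≟ x))

    collide : Fin m → Fin m → ℕ
    collide x x′ = 𝟙 (does (f x ≟ f x′))

    size : Fin m → ℕ
    size = fiberSize f

    foundInFiber : Fin m → ℕ
    foundInFiber x′ = ∑[ x ∈ allFin m ] found x * collide x x′

    inverted≤foundInFiber : ∀ x′ → 𝟙 (does (f (J (f x′)) ≟ f x′)) ≤ foundInFiber x′
    inverted≤foundInFiber x′ = 𝟙-≤ (f (J (f x′)) ≟ f x′) λ fJfx′≡fx′ →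
      let x₀ = J (f x′) in
      subst (_≤ foundInFiber x′)
        (cong₂ _*_ (𝟙-yes (J (f x₀) ≟ x₀) (cong J fJfx′≡fx′)) (𝟙-yes (f x₀ ≟ f x′) fJfx′≡fx′))
        (∑-∈-≤ (λ x → found x * collide x x′) (∈-allFin x₀))

    foundInFiber≤1 : ∀ x′ → foundInFiber x′ ≤ 1
    foundInFiber≤1 x′ = begin
      foundInFiber x′                               ≤⟨ ∑-mono-≤ (allFin m) (λ x →
        𝟙-*-≤ (J (f x) ≟ x) (f x ≟ f x′) (x ≟ J (f x′)) λ Jfx≡x fx≡fx′ → trans (sym Jfx≡x) (cong J fx≡fx′)) ⟩
      ∑[ x ∈ allFin m ] 𝟙 (does (x ≟ J (f x′)))     ≡⟨ ∑-indicator m (J (f x′)) ⟩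
      1                                             ∎
      where open ≤-Reasoning

    inverts≤∑found*size : inverts f J ≤ ∑[ x ∈ allFin m ] found x * size x
    inverts≤∑found*size = begin
      inverts f J                                                  ≤⟨ ∑-mono-≤ (allFin m) inverted≤foundInFiber ⟩
      ∑[ x′ ∈ allFin m ] ∑[ x ∈ allFin m ] found x * collide x x′  ≡⟨ ∑-comm (allFin m) (allFin m) _ ⟨
      ∑[ x ∈ allFin m ] ∑[ x′ ∈ allFin m ] found x * collide x x′  ≡⟨ ∑-cong (allFin m) (λ x → ∑-*ˡ (allFin m) (found x) (collide x)) ⟩
      ∑[ x ∈ allFin m ] found x * size x                           ∎
      where open ≤-Reasoning

    ∑found*size²≤collisions : ∑[ x ∈ allFin m ] found x * (size x * size x) ≤ collisions f
    ∑found*size²≤collisions = begin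
      ∑[ x ∈ allFin m ] found x * (size x * size x)
        ≡⟨ ∑-cong (allFin m) (λ x → cong (found x *_) (sym (∑-*ˡ (allFin m) (size x) (collide x)))) ⟩
      ∑[ x ∈ allFin m ] found x * (∑[ x′ ∈ allFin m ] size x * collide x x′)
        ≡⟨ ∑-cong (allFin m) (λ x → cong (found x *_) (∑-cong (allFin m) λ x′ →
             𝟙-*-cong (f x ≟ f x′) (fiberSize-cong f))) ⟩
      ∑[ x ∈ allFin m ] found x * (∑[ x′ ∈ allFin m ] size x′ * collide x x′)
        ≡⟨ ∑-cong (allFin m) (λ x → sym (∑-*ˡ (allFin m) (found x) _)) ⟩
      ∑[ x ∈ allFin m ] ∑[ x′ ∈ allFin m ] found x * (size x′ * collide x x′)
        ≡⟨ ∑-comm (allFin m) (allFin m) _ ⟩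
      ∑[ x′ ∈ allFin m ] ∑[ x ∈ allFin m ] found x * (size x′ * collide x x′)
        ≡⟨ ∑-cong (allFin m) (λ x′ → trans (∑-cong (allFin m) λ x → swap-factors (found x) (size x′) (collide x x′))
                                             (∑-*ˡ (allFin m) (size x′) _)) ⟩
      ∑[ x′ ∈ allFin m ] size x′ * foundInFiber x′
        ≤⟨ ∑-mono-≤ (allFin m) (λ x′ → *-monoʳ-≤ (size x′) (foundInFiber≤1 x′)) ⟩
      ∑[ x′ ∈ allFin m ] size x′ * 1
        ≡⟨ ∑-cong (allFin m) (λ x′ → *-identityʳ (size x′)) ⟩
      collisions f
        ∎
      where
      open ≤-Reasoning
      swap-factors : ∀ a b c → a * (b * c) ≡ b * (a * c)
      swap-factors = solve-∀

  inverts²≤finds*collisions : inverts f J * inverts f J ≤ finds f J * collisions f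
  inverts²≤finds*collisions = begin
    inverts f J * inverts f J
      ≤⟨ *-mono-≤ inverts≤∑found*size inverts≤∑found*size ⟩
    (∑[ x ∈ allFin m ] found x * size x) * (∑[ x ∈ allFin m ] found x * size x)
      ≤⟨ cauchy-schwarz (λ x → found x * size x) found (λ x → found x * (size x * size x))
                        (λ x → ≤-reflexive (square-split (found x) (size x))) (allFin m) ⟩
    finds f J * (∑[ x ∈ allFin m ] found x * (size x * size x))
      ≤⟨ *-monoʳ-≤ (finds f J) ∑found*size²≤collisions ⟩
    finds f J * collisions f
      ∎
    where
    open ≤-Reasoning
    square-split : ∀ a b → a * b * (a * b) ≡ a * (a * (b * b))
    square-split = solve-∀

∑-allFuns-suc : ∀ m k (H : (Fin (suc m) → Fin k) → ℕ) →
                ∑ (allFuns (suc m) k) H ≡ ∑[ y ∈ allFin k ] ∑[ g ∈ allFuns m k ] H (y ◂ g)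
∑-allFuns-suc m k H = trans (∑-concatMap (λ y → map (y ◂_) (allFuns m k)) (allFin k) H)
                            (∑-cong (allFin k) λ y → ∑-map (y ◂_) (allFuns m k) H)

∑-allFuns-const : ∀ m k c → ∑[ _ ∈ allFuns m k ] c ≡ k ^ m * c
∑-allFuns-const zero    k c = refl
∑-allFuns-const (suc m) k c = begin
  ∑[ _ ∈ allFuns (suc m) k ] c                 ≡⟨ ∑-allFuns-suc m k (λ _ → c) ⟩
  ∑[ _ ∈ allFin k ] (∑[ _ ∈ allFuns m k ] c)   ≡⟨ ∑-cong (allFin k) (λ _ → ∑-allFuns-const m k c) ⟩
  ∑[ _ ∈ allFin k ] k ^ m * c                  ≡⟨ ∑-allFin-const k (k ^ m * c) ⟩
  k * (k ^ m * c)                              ≡⟨ *-assoc k (k ^ m) c ⟨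
  k ^ suc m * c                                ∎
  where open ≡-Reasoning

preimageSize : Fin k → (Fin m → Fin k) → ℕ
preimageSize {m = m} y g = ∑[ x ∈ allFin m ] 𝟙 (does (g x ≟ y))

∑∑-preimageSize : ∀ m k → ∑[ y ∈ allFin k ] (∑[ g ∈ allFuns m k ] preimageSize y g) ≡ k ^ m * m
∑∑-preimageSize m k = begin
  ∑[ y ∈ allFin k ] (∑[ g ∈ allFuns m k ] preimageSize y g)
    ≡⟨ ∑-comm (allFin k) (allFuns m k) preimageSize ⟩
  ∑[ g ∈ allFuns m k ] (∑[ y ∈ allFin k ] ∑[ x ∈ allFin m ] 𝟙 (does (g x ≟ y)))
    ≡⟨ ∑-cong (allFuns m k) (λ g → ∑-comm (allFin k) (allFin m) (λ y x → 𝟙 (does (g x ≟ y)))) ⟩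
  ∑[ g ∈ allFuns m k ] (∑[ x ∈ allFin m ] ∑[ y ∈ allFin k ] 𝟙 (does (g x ≟ y)))
    ≡⟨ ∑-cong (allFuns m k) (λ g → ∑-cong (allFin m) (λ x → ∑-indicatorˡ k (g x))) ⟩
  ∑[ _ ∈ allFuns m k ] (∑[ _ ∈ allFin m ] 1)
    ≡⟨ ∑-cong (allFuns m k) (λ _ → trans (∑-allFin-const m 1) (*-identityʳ m)) ⟩
  ∑[ _ ∈ allFuns m k ] m
    ≡⟨ ∑-allFuns-const m k m ⟩
  k ^ m * m
    ∎
  where open ≡-Reasoning

collisions-◂ : ∀ (y : Fin k) (g : Fin m → Fin k) →
               collisions (y ◂ g) ≡ 1 + 2 * preimageSize y g + collisions g
collisions-◂ {k} {m} y g = begin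
  collisions (y ◂ g)
    ≡⟨ ∑-allFin-suc m (fiberSize (y ◂ g)) ⟩
  fiberSize (y ◂ g) zero + (∑[ x ∈ allFin m ] fiberSize (y ◂ g) (suc x))
    ≡⟨ cong₂ _+_ fiberSize-y (∑-cong (allFin m) (λ x → ∑-allFin-suc m (λ x′ → 𝟙 (does (g x ≟ (y ◂ g) x′))))) ⟩
  (1 + preimageSize y g) + (∑[ x ∈ allFin m ] 𝟙 (does (g x ≟ y)) + fiberSize g x)
    ≡⟨ cong ((1 + preimageSize y g) +_) (∑-distrib-+ (allFin m) _ (fiberSize g)) ⟩
  (1 + preimageSize y g) + (preimageSize y g + collisions g)
    ≡⟨ regroup 1 (preimageSize y g) (collisions g) ⟩
  1 + 2 * preimageSize y g + collisions g
    ∎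
  where
  open ≡-Reasoning
  fiberSize-y : fiberSize (y ◂ g) zero ≡ 1 + preimageSize y g
  fiberSize-y = trans (∑-allFin-suc m (λ x′ → 𝟙 (does (y ≟ (y ◂ g) x′))))
                      (cong₂ _+_ (𝟙-yes (y ≟ y) refl) (∑-cong (allFin m) (λ x′ → 𝟙-≟-sym y (g x′))))
  regroup : ∀ a p c → (a + p) + (p + c) ≡ a + 2 * p + c
  regroup = solve-∀

∑-collisions-suc : ∀ m k → ∑[ g ∈ allFuns (suc m) k ] collisions g ≡
                   k * k ^ m + 2 * (k ^ m * m) + k * (∑[ g ∈ allFuns m k ] collisions g)
∑-collisions-suc m k = begin
  ∑[ g ∈ allFuns (suc m) k ] collisions g
    ≡⟨ ∑-allFuns-suc m k collisions ⟩
  ∑[ y ∈ allFin k ] (∑[ g ∈ Fs ] collisions (y ◂ g))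
    ≡⟨ ∑-cong (allFin k) (λ y → trans (∑-cong Fs (collisions-◂ y)) (split y)) ⟩
  ∑[ y ∈ allFin k ] (k ^ m + 2 * (∑[ g ∈ Fs ] preimageSize y g) + T)
    ≡⟨ ∑-distrib-+ (allFin k) _ (λ _ → T) ⟩
  (∑[ y ∈ allFin k ] k ^ m + 2 * (∑[ g ∈ Fs ] preimageSize y g)) + (∑[ _ ∈ allFin k ] T)
    ≡⟨ cong₂ _+_ (∑-distrib-+ (allFin k) (λ _ → k ^ m) _) (∑-allFin-const k T) ⟩
  (∑[ _ ∈ allFin k ] k ^ m) + (∑[ y ∈ allFin k ] 2 * (∑[ g ∈ Fs ] preimageSize y g)) + k * T
    ≡⟨ cong (_+ k * T) (cong₂ _+_ (∑-allFin-const k (k ^ m))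
                                  (trans (∑-*ˡ (allFin k) 2 _) (cong (2 *_) (∑∑-preimageSize m k)))) ⟩
  k * k ^ m + 2 * (k ^ m * m) + k * T
    ∎
  where
  open ≡-Reasoning
  Fs : List (Fin m → Fin k)
  Fs = allFuns m k
  T : ℕ
  T = ∑[ g ∈ Fs ] collisions g
  split : ∀ y → ∑[ g ∈ Fs ] (1 + 2 * preimageSize y g + collisions g) ≡
                k ^ m + 2 * (∑[ g ∈ Fs ] preimageSize y g) + T
  split y = trans (∑-distrib-+ Fs _ collisions)
                  (cong (_+ T) (trans (∑-distrib-+ Fs (λ _ → 1) _)
                    (cong₂ _+_ (trans (∑-allFuns-const m k 1) (*-identityʳ (k ^ m)))
                               (∑-*ˡ Fs 2 (preimageSize y)))))

-- k · ∑ collisions = kᵐ · m (k + m − 1), stated without truncated subtraction.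
∑-collisions : ∀ m k → k * (∑[ g ∈ allFuns m k ] collisions g) + k ^ m * m ≡ k ^ m * m * (k + m)
∑-collisions zero    k = cong (_+ 0) (*-zeroʳ k)
∑-collisions (suc m) k = begin
  k * (∑[ g ∈ allFuns (suc m) k ] collisions g) + k ^ suc m * suc m
    ≡⟨ cong (λ t → k * t + k ^ suc m * suc m) (∑-collisions-suc m k) ⟩
  k * (k * k ^ m + 2 * (k ^ m * m) + k * T) + k * k ^ m * suc m
    ≡⟨ regroup k (k ^ m) m T ⟩
  k * (k * k ^ m + 2 * (k ^ m * m) + k ^ m) + k * (k * T + k ^ m * m)
    ≡⟨ cong (λ t → k * (k * k ^ m + 2 * (k ^ m * m) + k ^ m) + k * t) (∑-collisions m k) ⟩
  k * (k * k ^ m + 2 * (k ^ m * m) + k ^ m) + k * (k ^ m * m * (k + m))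
    ≡⟨ close k (k ^ m) m ⟩
  k * k ^ m * suc m * (k + suc m)
    ∎
  where
  open ≡-Reasoning
  T : ℕ
  T = ∑[ g ∈ allFuns m k ] collisions g
  regroup : ∀ k K m T → k * (k * K + 2 * (K * m) + k * T) + k * K * suc m ≡
                        k * (k * K + 2 * (K * m) + K) + k * (k * T + K * m)
  regroup = solve-∀
  close : ∀ k K m → k * (k * K + 2 * (K * m) + K) + k * (K * m * (k + m)) ≡ k * K * suc m * (k + suc m)
  close = solve-∀

∑-collisions≤2nⁿ⁺¹ : ∀ n .{{_ : NonZero n}} → ∑[ g ∈ allFuns n n ] collisions g ≤ 2 * (n ^ n * n)
∑-collisions≤2nⁿ⁺¹ n = *-cancelˡ-≤ n (begin
  n * (∑[ g ∈ allFuns n n ] collisions g)               ≤⟨ m≤m+n _ (n ^ n * n) ⟩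
  n * (∑[ g ∈ allFuns n n ] collisions g) + n ^ n * n   ≡⟨ ∑-collisions n n ⟩
  n ^ n * n * (n + n)                                   ≡⟨ rearrange n (n ^ n) ⟩
  n * (2 * (n ^ n * n))                                 ∎)
  where
  open ≤-Reasoning
  rearrange : ∀ n N → N * n * (n + n) ≡ n * (2 * (N * n))
  rearrange = solve-∀

-- countPairs n (invertsEvent n Inv) unfolds to ∑[ f ∈ allFuns n n ] inverts f (Inv f), and likewise for finds.
countInverts²≤countFinds*2nⁿ⁺¹ : ∀ n .{{_ : NonZero n}} (Inv : (Fin n → Fin n) → Fin n → Fin n) →
  countPairs n (invertsEvent n Inv) * countPairs n (invertsEvent n Inv) ≤
  countPairs n (findsEvent n Inv) * (2 * (n ^ n * n))
countInverts²≤countFinds*2nⁿ⁺¹ n Inv = begin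
  countPairs n (invertsEvent n Inv) * countPairs n (invertsEvent n Inv)
    ≤⟨ cauchy-schwarz (λ f → inverts f (Inv f)) (λ f → finds f (Inv f)) collisions
                      (λ f → inverts²≤finds*collisions f (Inv f)) (allFuns n n) ⟩
  countPairs n (findsEvent n Inv) * (∑[ g ∈ allFuns n n ] collisions g)
    ≤⟨ *-monoʳ-≤ (countPairs n (findsEvent n Inv)) (∑-collisions≤2nⁿ⁺¹ n) ⟩
  countPairs n (findsEvent n Inv) * (2 * (n ^ n * n))
    ∎
  where open ≤-Reasoning

toℚᵘ-/ : ∀ i d .{{_ : NonZero d}} → ℚ.toℚᵘ (i ℚ./ d) ℚᵘ.≃ i ℚᵘ./ d
toℚᵘ-/ i (suc d) = ℚ.toℚᵘ-fromℚᵘ (ℚᵘ.mkℚᵘ i d)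

[i/d]²*⅛≤ᵘj/d : ∀ i j d .{{_ : NonZero d}} → i * i ≤ j * (2 * d) →
                ((ℤ.+ i ℚᵘ./ d) ℚᵘ.* (ℤ.+ i ℚᵘ./ d)) ℚᵘ.* (ℤ.+ 1 ℚᵘ./ 8) ℚᵘ.≤ ℤ.+ j ℚᵘ./ d
[i/d]²*⅛≤ᵘj/d i j d@(suc _) i²≤2jd = ℚᵘ.*≤* (subst₂ ℤ._≤_ lhs rhs (ℤ.+≤+ (begin
  i * i * 1 * d      ≡⟨ cong (_* d) (*-identityʳ (i * i)) ⟩
  i * i * d          ≤⟨ *-monoˡ-≤ d i²≤2jd ⟩
  j * (2 * d) * d    ≤⟨ *-monoˡ-≤ d (*-monoʳ-≤ j (*-monoˡ-≤ d {2} {8} (s≤s (s≤s z≤n)))) ⟩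
  j * (8 * d) * d    ≡⟨ rearrange j d ⟩
  j * (d * d * 8)    ∎)))
  where
  open ≤-Reasoning
  rearrange : ∀ j d → j * (8 * d) * d ≡ j * (d * d * 8)
  rearrange = solve-∀
  lhs : ℤ.+ (i * i * 1 * d) ≡ (ℤ.+ i ℤ.* ℤ.+ i ℤ.* ℤ.+ 1) ℤ.* ℤ.+ d
  lhs = trans (ℤ.pos-* (i * i * 1) d)
              (cong (ℤ._* ℤ.+ d) (trans (ℤ.pos-* (i * i) 1) (cong (ℤ._* ℤ.+ 1) (ℤ.pos-* i i))))
  rhs : ℤ.+ (j * (d * d * 8)) ≡ ℤ.+ j ℤ.* ℤ.+ (d * d * 8)
  rhs = ℤ.pos-* j (d * d * 8)

[i/d]²*⅛≤j/d : ∀ i j d .{{_ : NonZero d}} → i * i ≤ j * (2 * d) →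
               ((ℤ.+ i ℚ./ d) ℚ.* (ℤ.+ i ℚ./ d)) ℚ.* (ℤ.+ 1 ℚ./ 8) ℚ.≤ ℤ.+ j ℚ./ d
[i/d]²*⅛≤j/d i j d i²≤2jd = ℚ.toℚᵘ-cancel-≤ (begin
  ℚ.toℚᵘ ((p ℚ.* p) ℚ.* ⅛)
    ≃⟨ ℚ.toℚᵘ-homo-* (p ℚ.* p) ⅛ ⟩
  ℚ.toℚᵘ (p ℚ.* p) ℚᵘ.* ℚ.toℚᵘ ⅛
    ≃⟨ ℚᵘ.*-cong (ℚᵘ.≃-trans (ℚ.toℚᵘ-homo-* p p) (ℚᵘ.*-cong (toℚᵘ-/ (ℤ.+ i) d) (toℚᵘ-/ (ℤ.+ i) d)))
                 (toℚᵘ-/ (ℤ.+ 1) 8) ⟩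
  ((ℤ.+ i ℚᵘ./ d) ℚᵘ.* (ℤ.+ i ℚᵘ./ d)) ℚᵘ.* (ℤ.+ 1 ℚᵘ./ 8)
    ≤⟨ [i/d]²*⅛≤ᵘj/d i j d i²≤2jd ⟩
  ℤ.+ j ℚᵘ./ d
    ≃⟨ toℚᵘ-/ (ℤ.+ j) d ⟨
  ℚ.toℚᵘ (ℤ.+ j ℚ./ d)
    ∎)
  where
  open ℚᵘ.≤-Reasoning
  p ⅛ : ℚ.ℚ
  p = ℤ.+ i ℚ./ d
  ⅛ = ℤ.+ 1 ℚ./ 8

0≤p≤q⇒p*p≤q*q : ∀ {p q} → ℚ.0ℚ ℚ.≤ p → p ℚ.≤ q → p ℚ.* p ℚ.≤ q ℚ.* q
0≤p≤q⇒p*p≤q*q {p} {q} 0≤p p≤q = ℚ.≤-trans (ℚ.*-monoˡ-≤-nonNeg p p≤q) (ℚ.*-monoʳ-≤-nonNeg q p≤q)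
  where instance
  _ : ℚ.NonNegative p
  _ = ℚ.nonNegative 0≤p
  _ : ℚ.NonNegative q
  _ = ℚ.nonNegative (ℚ.≤-trans 0≤p p≤q)

claim3p8 : (n : ℕ) → .{{_ : NonZero n}} → (Inv : (Fin n → Fin n) → Fin n → Fin n) → (α : ℚ.ℚ) →
           ℚ.0ℚ ℚ.≤ α → α ℚ.≤ Pr n (invertsEvent n Inv) →
           (α ℚ.* α) ℚ.* (ℤ.+ 1 ℚ./ 8) ℚ.≤ Pr n (findsEvent n Inv)
claim3p8 n Inv α 0≤α α≤Pr = begin
  (α ℚ.* α) ℚ.* ⅛
    ≤⟨ ℚ.*-monoʳ-≤-nonNeg ⅛ (0≤p≤q⇒p*p≤q*q 0≤α α≤Pr) ⟩
  (Pr n (invertsEvent n Inv) ℚ.* Pr n (invertsEvent n Inv)) ℚ.* ⅛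
    ≤⟨ [i/d]²*⅛≤j/d (countPairs n (invertsEvent n Inv)) (countPairs n (findsEvent n Inv))
                    (n ^ n * n) {{m*n≢0 (n ^ n) n {{m^n≢0 n n}}}} (countInverts²≤countFinds*2nⁿ⁺¹ n Inv) ⟩
  Pr n (findsEvent n Inv)
    ∎
  where
  open ℚ.≤-Reasoning
  ⅛ : ℚ.ℚ
  ⅛ = ℤ.+ 1 ℚ./ 8
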